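{- Let $n\ge 2$, $S_n=\{1,\dots,n\}$, and let $\mathbb{K}^1_n=(S_n\cup\{g_1\},S_n\cup\{m_1,m_2\},I)$ where $g_1,m_1,m_2$ are new elements and $gIm$ holds iff either $g,m\in S_n$ and $g\neq m$; or $g=g_1$ and $m\in S_n$; or $g=1$ and $m=m_1$; or $g\in S_n\setminus\{1\}$ and $m=m_2$. Let $\mathbb{K}^1_{n\mathrm{ge}}=(S_n\cup\{g_1\},S_n\cup\{m_{12}\},J)$ be obtained by replacing $m_1,m_2$ with a single attribute $m_{12}$ where $J$ agrees with $I$ on attributes in $S_n$ and $g\,J\,m_{12}$ iff $g\,I\,m_1$ or $g\,I\,m_2$. Then $|\mathfrak{B}(\mathbb{K}^1_{n\mathrm{ge}})|-|\mathfrak{B}(\mathbb{K}^1_n)|=2^{n-1}-1$.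
   Context: A formal context $(G,M,I)$ has objects $G$, attributes $M$, incidence $I\subseteq G\times M$. A formal concept is a pair $(A,B)$, $A\subseteq G$, $B\subseteq M$, such that $B$ is exactly the set of attributes shared by all objects of $A$ and $A$ is exactly the set of objects having all attributes in $B$. $\mathfrak{B}(\mathbb{K})$ is the set of concepts of $\mathbb{K}$. Replacing two attributes by one whose object set is the union of theirs is called an existential ($\exists$-)generalization. -}

module Defs where

open import Data.Nat using (ℕ; zero; suc)
open import Data.Bool using (Bool; true; false; _∧_; _∨_; not)
open import Data.Fin using (Fin; zero; suc)
open import Data.Fin.Properties using (_≟_)
open import Data.Vec using (Vec; lookup; tabulate)
open import Data.Product using (Σ; _×_; _,_)
open import Relation.Binary.PropositionalEquality using (_≡_)
open import Relation.Nullary.Decidable using (⌊_⌋)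

Context : ℕ → ℕ → Set
Context p q = Fin p → Fin q → Bool

Sub : ℕ → Set
Sub k = Vec Bool k

allFin : ∀ {k} → (Fin k → Bool) → Bool
allFin {zero}  f = true
allFin {suc k} f = f zero ∧ allFin (λ i → f (suc i))

_↑_ : ∀ {p q} → Context p q → Sub p → Sub q
I ↑ A = tabulate λ m → allFin λ g → not (lookup A g) ∨ I g m

_↓_ : ∀ {p q} → Context p q → Sub q → Sub p
I ↓ B = tabulate λ g → allFin λ m → not (lookup B m) ∨ I g m

Concept : ∀ {p q} → Context p q → Set
Concept {p} {q} I = Σ (Sub p × Sub q) λ { (A , B) → ((I ↑ A) ≡ B) × ((I ↓ B) ≡ A) }

-- Encoding of the contexts of Proposition 4.
-- Objects S_n ∪ {g₁} : Fin (suc n), where zero = g₁ and suc i = element i+1 of S_n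
--   (so suc zero is the element 1 of S_n).
-- Attributes of K¹ₙ : Fin (suc (suc n)), where zero = m₁, suc zero = m₂,
--   suc (suc j) = element j+1 of S_n.
-- Attributes of K¹ₙge : Fin (suc n), where zero = m₁₂, suc j = element j+1 of S_n.

isOne : ∀ {n} → Fin n → Bool
isOne zero    = true
isOne (suc _) = false

K1 : (n : ℕ) → Context (suc n) (suc (suc n))
K1 n zero    zero          = false
K1 n zero    (suc zero)    = false
K1 n zero    (suc (suc j)) = true
K1 n (suc i) zero          = isOne i
K1 n (suc i) (suc zero)    = not (isOne i)
K1 n (suc i) (suc (suc j)) = not ⌊ i ≟ j ⌋

K1ge : (n : ℕ) → Context (suc n) (suc n)
K1ge n g zero    = K1 n g zero ∨ K1 n g (suc zero)
K1ge n g (suc j) = K1 n g (suc (suc j))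

-- Concepts of any context are in bijection with their extents, i.e. with the
-- subsets A satisfying A = A↑↓ (the closed subsets).  A subset A is closed iff
-- every object g ∉ A is *separated* from A by an attribute that all of A has
-- but g lacks; this criterion holds for arbitrary finite contexts.
--
-- In both contexts an object i ∈ Sₙ is separated by its own attribute i.  The
-- only remaining object is g₁:
--   * in 𝕂¹ₙge, g₁ is always separated by m₁₂, so all 2ⁿ⁺¹ subsets are closed;
--   * in 𝕂¹ₙ (n = m + 1), A ∌ g₁ is closed iff 1 ∉ A (separator m₂) or A = {1}
--     (separator m₁), giving 2ⁿ (with g₁) + 2ⁿ⁻¹ (without g₁, 1) + 1 extents.
-- The theorem follows from 2ⁿ⁺¹ − (2ⁿ + 2ⁿ⁻¹ + 1) = 2ⁿ⁻¹ − 1.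
module Submission where

open import Defs
open import Data.Nat using (ℕ; _≤_; _^_; _∸_; zero; suc; _+_; _*_)
open import Data.Integer using (+_; _-_; _⊖_)
open import Data.Integer.Properties using ([+m]-[+n]≡m⊖n; +-cancelˡ-⊖)
open import Data.Fin using (Fin; zero; suc)
open import Data.Fin.Properties using (_≟_; +↔⊎; *↔×)
open import Data.Product using (∃-syntax; _×_; Σ; _,_; proj₁)
open import Data.Sum using (_⊎_; inj₁; inj₂)
open import Data.Sum.Function.Propositional using (_⊎-↔_)
open import Data.Product.Function.NonDependent.Propositional using (_×-↔_)
open import Function.Bundles using (_↔_; mk↔ₛ′)
open import Function.Properties.Inverse using (↔-trans; ↔-sym; ↔-refl)
open import Relation.Binary.PropositionalEquality
  using (_≡_; refl; sym; trans; cong; cong₂; module ≡-Reasoning)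
open import Data.Bool using (Bool; true; false; _∨_; not)
import Data.Bool.Properties as Bool
open import Data.Vec using ([]; _∷_; lookup)
open import Data.Vec.Properties using (lookup∘tabulate; tabulate∘lookup; tabulate-cong; ≡-dec)
open import Data.Empty using (⊥-elim)
open import Relation.Nullary using (yes; no)
open import Relation.Nullary.Decidable using (⌊_⌋)
import Axiom.UniquenessOfIdentityProofs as UIP
open import Data.Nat.Tactic.RingSolver using (solve-∀)

implies-intro : ∀ a b → (a ≡ true → b ≡ true) → not a ∨ b ≡ true
implies-intro false b h = refl
implies-intro true  b h = h refl

implies-elim : ∀ a b → not a ∨ b ≡ true → a ≡ true → b ≡ true
implies-elim true b h refl = h

implies-false : ∀ a b → not a ∨ b ≡ false → (a ≡ true) × (b ≡ false)
implies-false true  false refl = refl , refl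

allFin-intro : ∀ {k} (f : Fin k → Bool) → (∀ i → f i ≡ true) → allFin f ≡ true
allFin-intro {zero}  f h = refl
allFin-intro {suc k} f h rewrite h zero = allFin-intro (λ j → f (suc j)) (λ i → h (suc i))

allFin-elim : ∀ {k} (f : Fin k → Bool) → allFin f ≡ true → ∀ i → f i ≡ true
allFin-elim {suc k} f h i with f zero in f0
allFin-elim {suc k} f h zero    | true = f0
allFin-elim {suc k} f h (suc i) | true = allFin-elim (λ j → f (suc j)) h i

allFin-refute : ∀ {k} (f : Fin k → Bool) (i : Fin k) → f i ≡ false → allFin f ≡ false
allFin-refute f zero    fi rewrite fi = refl
allFin-refute f (suc i) fi with f zero
... | true  = allFin-refute (λ j → f (suc j)) i fi
... | false = refl

allFin-counterexample : ∀ {k} (f : Fin k → Bool) → allFin f ≡ false → Σ (Fin k) λ i → f i ≡ false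
allFin-counterexample {suc k} f h with f zero in f0
... | false = zero , f0
... | true with allFin-counterexample (λ j → f (suc j)) h
...   | i , fi = suc i , fi

sub-ext : ∀ {k} (u v : Sub k) → (∀ i → lookup u i ≡ lookup v i) → u ≡ v
sub-ext u v h = trans (sym (tabulate∘lookup u)) (trans (tabulate-cong h) (tabulate∘lookup v))

∅ : ∀ k → Sub k
∅ zero    = []
∅ (suc k) = false ∷ ∅ k

∉∅ : ∀ {k} (j : Fin k) → lookup (∅ k) j ≡ false
∉∅ zero    = refl
∉∅ (suc j) = ∉∅ j

module _ {p q : ℕ} (I : Context p q) where

  Closed : Sub p → Set
  Closed A = I ↓ (I ↑ A) ≡ A

  Separates : Sub p → Fin p → Fin q → Set
  Separates A g m = (I g m ≡ false) × (∀ g′ → lookup A g′ ≡ true → I g′ m ≡ true)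

  ∈↑-intro : ∀ A m → (∀ g → lookup A g ≡ true → I g m ≡ true) → lookup (I ↑ A) m ≡ true
  ∈↑-intro A m h = trans (lookup∘tabulate _ m)
    (allFin-intro _ λ g → implies-intro (lookup A g) (I g m) (h g))

  ∈↑-elim : ∀ A m → lookup (I ↑ A) m ≡ true → ∀ g → lookup A g ≡ true → I g m ≡ true
  ∈↑-elim A m h g = implies-elim (lookup A g) (I g m)
    (allFin-elim _ (trans (sym (lookup∘tabulate _ m)) h) g)

  closure-extensive : ∀ A g → lookup A g ≡ true → lookup (I ↓ (I ↑ A)) g ≡ true
  closure-extensive A g g∈A = trans (lookup∘tabulate _ g) (allFin-intro _ λ m →
    implies-intro (lookup (I ↑ A) m) (I g m) λ m∈A↑ → ∈↑-elim A m m∈A↑ g g∈A)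

  closure-excludes : ∀ A g m → Separates A g m → lookup (I ↓ (I ↑ A)) g ≡ false
  closure-excludes A g m (¬gm , A⊆m) = trans (lookup∘tabulate _ g) (allFin-refute _ m refuted)
    where
    refuted : not (lookup (I ↑ A) m) ∨ I g m ≡ false
    refuted rewrite ∈↑-intro A m A⊆m = ¬gm

  closure-separator : ∀ A g → lookup (I ↓ (I ↑ A)) g ≡ false → Σ (Fin q) (Separates A g)
  closure-separator A g g∉cl
    with allFin-counterexample _ (trans (sym (lookup∘tabulate _ g)) g∉cl)
  ... | m , bad with implies-false (lookup (I ↑ A) m) (I g m) bad
  ...   | m∈A↑ , ¬gm = m , ¬gm , ∈↑-elim A m m∈A↑

  closed-intro : ∀ A → (∀ g → lookup A g ≡ false → Σ (Fin q) (Separates A g)) → Closed A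
  closed-intro A sep = sub-ext _ _ pointwise
    where
    pointwise : ∀ g → lookup (I ↓ (I ↑ A)) g ≡ lookup A g
    pointwise g with lookup A g in g∈?A
    ... | true  = closure-extensive A g g∈?A
    ... | false with sep g g∈?A
    ...   | m , m-separates = closure-excludes A g m m-separates

  closed-separator : ∀ A → Closed A → ∀ g → lookup A g ≡ false → Σ (Fin q) (Separates A g)
  closed-separator A closed g g∉A =
    closure-separator A g (trans (cong (λ C → lookup C g) closed) g∉A)

  closed-irrelevant : ∀ {A} (c c′ : Closed A) → c ≡ c′
  closed-irrelevant = UIP.Decidable⇒UIP.≡-irrelevant (≡-dec Bool._≟_)

  closed-≡ : ∀ {A A′} {c : Closed A} {c′ : Closed A′} → A ≡ A′ →
             _≡_ {A = Σ (Sub p) Closed} (A , c) (A′ , c′)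
  closed-≡ {c = c} {c′} refl = cong (_ ,_) (closed-irrelevant c c′)

  closed↔concept : Σ (Sub p) Closed ↔ Concept I
  closed↔concept = mk↔ₛ′ to from to∘from from∘to
    where
    to : Σ (Sub p) Closed → Concept I
    to (A , c) = (A , I ↑ A) , refl , c
    from : Concept I → Σ (Sub p) Closed
    from ((A , _) , refl , c) = A , c
    to∘from : ∀ x → to (from x) ≡ x
    to∘from ((A , _) , refl , c) = refl
    from∘to : ∀ x → from (to x) ≡ x
    from∘to (A , c) = refl

fin2↔bool : Fin 2 ↔ Bool
fin2↔bool = mk↔ₛ′ to from to∘from from∘to
  where
  to : Fin 2 → Bool
  to zero       = false
  to (suc zero) = true
  from : Bool → Fin 2
  from false = zero
  from true  = suc zero
  to∘from : ∀ b → to (from b) ≡ b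
  to∘from false = refl
  to∘from true  = refl
  from∘to : ∀ i → from (to i) ≡ i
  from∘to zero       = refl
  from∘to (suc zero) = refl

bool×sub↔sub : ∀ k → (Bool × Sub k) ↔ Sub (suc k)
bool×sub↔sub k = mk↔ₛ′ (λ (b , v) → b ∷ v) split (λ { (b ∷ v) → refl }) (λ _ → refl)
  where
  split : Sub (suc k) → Bool × Sub k
  split (b ∷ v) = b , v

fin2^↔sub : ∀ k → Fin (2 ^ k) ↔ Sub k
fin2^↔sub zero    = mk↔ₛ′ (λ _ → []) (λ _ → zero) (λ { [] → refl }) (λ { zero → refl })
fin2^↔sub (suc k) = ↔-trans *↔× (↔-trans (fin2↔bool ×-↔ fin2^↔sub k) (bool×sub↔sub k))

-- In both contexts an object i ∈ Sₙ lacks its own attribute i, which every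
-- other object has; so i is separated from any A ∌ i by that attribute.
own-attribute-separates : ∀ n (A : Sub (suc n)) i → lookup A (suc i) ≡ false →
                          Separates (K1 n) A (suc i) (suc (suc i))
own-attribute-separates n A i i∉A = lacks-own , others-have
  where
  lacks-own : not ⌊ i ≟ i ⌋ ≡ false
  lacks-own with i ≟ i
  ... | yes _   = refl
  ... | no i≢i = ⊥-elim (i≢i refl)
  others-have : ∀ g → lookup A g ≡ true → K1 n g (suc (suc i)) ≡ true
  others-have zero     _   = refl
  others-have (suc j) j∈A with j ≟ i
  ... | no _     = refl
  ... | yes refl with () ← trans (sym j∈A) i∉A

-- In 𝕂¹ₙge, m₁₂ is had by every object of Sₙ and missing from g₁, hence every
-- subset of objects is closed.
K1ge-closed : ∀ n A → Closed (K1ge n) A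
K1ge-closed n A = closed-intro (K1ge n) A separator
  where
  Sₙ-has-m₁₂ : ∀ g → lookup A g ≡ true → lookup A zero ≡ false → K1ge n g zero ≡ true
  Sₙ-has-m₁₂ zero             g₁∈A g₁∉A with () ← trans (sym g₁∈A) g₁∉A
  Sₙ-has-m₁₂ (suc zero)       _    _    = refl
  Sₙ-has-m₁₂ (suc (suc i))    _    _    = refl
  separator : ∀ g → lookup A g ≡ false → Σ (Fin (suc n)) (Separates (K1ge n) A g)
  separator zero    g₁∉A = zero , refl , λ g g∈A → Sₙ-has-m₁₂ g g∈A g₁∉A
  separator (suc i) i∉A  = suc i , own-attribute-separates n A i i∉A

K1ge-closed↔sub : ∀ n → Σ (Sub (suc n)) (Closed (K1ge n)) ↔ Sub (suc n)
K1ge-closed↔sub n = mk↔ₛ′ proj₁ (λ A → A , K1ge-closed n A) (λ _ → refl)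
  (λ _ → closed-≡ (K1ge n) refl)

-- In 𝕂¹ₙ every object of Sₙ is separated by its own attribute, so closedness
-- only concerns g₁.
K1-closed-intro : ∀ n A → (lookup A zero ≡ false → Σ (Fin (suc (suc n))) (Separates (K1 n) A zero)) →
                  Closed (K1 n) A
K1-closed-intro n A g₁-separator = closed-intro (K1 n) A separator
  where
  separator : ∀ g → lookup A g ≡ false → Σ (Fin (suc (suc n))) (Separates (K1 n) A g)
  separator zero    g₁∉A = g₁-separator g₁∉A
  separator (suc i) i∉A  = suc (suc i) , own-attribute-separates n A i i∉A

-- The closed subsets of 𝕂¹ₙ for n = m + 1, writing a subset as (g₁?, 1?, rest):
-- every subset containing g₁ is closed;
K1-closed-with-g₁ : ∀ m v → Closed (K1 (suc m)) (true ∷ v)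
K1-closed-with-g₁ m v = K1-closed-intro (suc m) _ λ ()

-- a subset avoiding g₁ and 1 is closed, g₁ being separated by m₂;
K1-closed-without-1 : ∀ m Y → Closed (K1 (suc m)) (false ∷ false ∷ Y)
K1-closed-without-1 m Y = K1-closed-intro (suc m) _ λ _ → suc zero , refl , has-m₂
  where
  has-m₂ : ∀ g → lookup (false ∷ false ∷ Y) g ≡ true → K1 (suc m) g (suc zero) ≡ true
  has-m₂ (suc (suc j)) _ = refl

-- {1} is closed, g₁ being separated by m₁;
K1-closed-singleton-1 : ∀ m → Closed (K1 (suc m)) (false ∷ true ∷ ∅ m)
K1-closed-singleton-1 m = K1-closed-intro (suc m) _ λ _ → zero , refl , has-m₁
  where
  has-m₁ : ∀ g → lookup (false ∷ true ∷ ∅ m) g ≡ true → K1 (suc m) g zero ≡ true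
  has-m₁ (suc zero)    _   = refl
  has-m₁ (suc (suc j)) j∈∅ with () ← trans (sym j∈∅) (∉∅ j)

-- and every closed subset containing 1 but not g₁ is {1}: the only
-- attribute that can separate g₁ is m₁, which no object besides 1 has.
K1-closed-with-1 : ∀ m Y → Closed (K1 (suc m)) (false ∷ true ∷ Y) → Y ≡ ∅ m
K1-closed-with-1 m Y closed with closed-separator (K1 (suc m)) _ closed zero refl
... | suc zero , _ , has-m₂ with () ← has-m₂ (suc zero) refl
... | zero     , _ , has-m₁ = sub-ext Y (∅ m) Y⊆∅
  where
  Y⊆∅ : ∀ j → lookup Y j ≡ lookup (∅ m) j
  Y⊆∅ j with lookup Y j in j∈?Y
  ... | false = sym (∉∅ j)
  ... | true with () ← has-m₁ (suc (suc j)) j∈?Y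

K1-closed↔ : ∀ m → Σ (Sub (suc (suc m))) (Closed (K1 (suc m))) ↔ (Sub (suc m) ⊎ (Sub m ⊎ Fin 1))
K1-closed↔ m = mk↔ₛ′ to from to∘from from∘to
  where
  to : Σ _ (Closed (K1 (suc m))) → Sub (suc m) ⊎ (Sub m ⊎ Fin 1)
  to (true ∷ v , _)          = inj₁ v
  to (false ∷ false ∷ Y , _) = inj₂ (inj₁ Y)
  to (false ∷ true ∷ _ , _)  = inj₂ (inj₂ zero)
  from : Sub (suc m) ⊎ (Sub m ⊎ Fin 1) → Σ _ (Closed (K1 (suc m)))
  from (inj₁ v)           = true ∷ v , K1-closed-with-g₁ m v
  from (inj₂ (inj₁ Y))    = false ∷ false ∷ Y , K1-closed-without-1 m Y
  from (inj₂ (inj₂ zero)) = false ∷ true ∷ ∅ m , K1-closed-singleton-1 m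
  to∘from : ∀ x → to (from x) ≡ x
  to∘from (inj₁ v)           = refl
  to∘from (inj₂ (inj₁ Y))    = refl
  to∘from (inj₂ (inj₂ zero)) = refl
  from∘to : ∀ x → from (to x) ≡ x
  from∘to (true ∷ v , _)          = closed-≡ (K1 (suc m)) refl
  from∘to (false ∷ false ∷ Y , _) = closed-≡ (K1 (suc m)) refl
  from∘to (false ∷ true ∷ Y , c)  =
    closed-≡ (K1 (suc m)) (cong (λ Z → false ∷ true ∷ Z) (sym (K1-closed-with-1 m Y c)))

-- 2ⁿ⁺¹ − (2ⁿ + (2ⁿ⁻¹ + 1)) = 2ⁿ⁻¹ − 1, written with x = 2ⁿ⁻¹.
count-difference : ∀ x → (+ (2 * (2 * x))) - (+ (2 * x + (x + 1))) ≡ (+ x) - (+ 1)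
count-difference x = begin
  (+ (2 * (2 * x))) - (+ (2 * x + (x + 1))) ≡⟨ [+m]-[+n]≡m⊖n (2 * (2 * x)) (2 * x + (x + 1)) ⟩
  2 * (2 * x) ⊖ (2 * x + (x + 1))           ≡⟨ cong₂ _⊖_ (four x) (three-plus-one x) ⟩
  (2 * x + x) + x ⊖ ((2 * x + x) + 1)       ≡⟨ +-cancelˡ-⊖ (2 * x + x) x 1 ⟩
  x ⊖ 1                                     ≡⟨ sym ([+m]-[+n]≡m⊖n x 1) ⟩
  (+ x) - (+ 1)                             ∎
  where
  open ≡-Reasoning
  four : ∀ x → 2 * (2 * x) ≡ (2 * x + x) + x
  four = solve-∀
  three-plus-one : ∀ x → 2 * x + (x + 1) ≡ (2 * x + x) + 1
  three-plus-one = solve-∀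

proposition4 : (n : ℕ) → 2 ≤ n →
    ∃[ a ] ∃[ b ] ((Fin a ↔ Concept (K1 n)) × (Fin b ↔ Concept (K1ge n))
    × ((+ b) - (+ a) ≡ (+ (2 ^ (n ∸ 1))) - (+ 1)))
proposition4 (suc m) _ = 2 ^ suc m + (2 ^ m + 1) , 2 ^ suc (suc m) ,
  K1-count , K1ge-count , count-difference (2 ^ m)
  where
  K1-count : Fin (2 ^ suc m + (2 ^ m + 1)) ↔ Concept (K1 (suc m))
  K1-count = ↔-trans +↔⊎ (↔-trans (fin2^↔sub (suc m) ⊎-↔ ↔-trans +↔⊎ (fin2^↔sub m ⊎-↔ ↔-refl))
               (↔-trans (↔-sym (K1-closed↔ m)) (closed↔concept (K1 (suc m)))))
  K1ge-count : Fin (2 ^ suc (suc m)) ↔ Concept (K1ge (suc m))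
  K1ge-count = ↔-trans (fin2^↔sub (suc (suc m)))
                 (↔-trans (↔-sym (K1ge-closed↔sub (suc m))) (closed↔concept (K1ge (suc m))))
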